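{- Let $F=(W,\sim)$ be a $\kappa$-frame and consider the unravelled frame $U(F)$. If $h_1,h_n$ are histories with $(h_1,h_n)\in\approx_G$ for some agent pattern $G$, then $h_1$ and $h_n$ have a common prefix (a history that is a prefix of both).
   Context: Fix a finite set $\mathsf{Ag}$ of agents; an agent pattern is a set $G\subseteq\mathcal{P}(\mathsf{Ag})\setminus\{\emptyset\}$. A frame is a pair $F=(W,\sim)$ where $\sim$ assigns to each agent pattern $G$ a symmetric and transitive relation $\sim_G$ on $W$. Let $\mathsf{alive}(G)=\{w\mid w\sim_G w\}$. $F$ is a $\kappa$-frame if for all agent patterns $G,H$: (K1) $\mathsf{alive}(G)\cap\mathsf{alive}(H)\subseteq\mathsf{alive}(G\cup H)$; (K2) $\mathsf{alive}(G)\subseteq\mathsf{alive}(\{A\cup B\})$ for $A,B\in G$; (K3) $\sim_H\subseteq\sim_G$ if $G\subseteq H$; (K4) $\sim_G\subseteq\sim_{G\cup\{B\}}$ if some $A\in G$ has $\emptyset\ne B\subseteq A$; (NE) every $w$ has some $G$ with $w\sim_G w$. A history over $F$ is a nonempty finite sequence of triples $(w,G,v)$ such that for each triple $w\sim_G v$ and $G$ is maximal under set inclusion among agent patterns $G'$ with $w\sim_{G'}v$, and consecutive triples $(w,G,v),(w',G',v')$ satisfy $v=w'$. $\ell(h)$ is the last world of $h$; $h\parallel(\ell(h),G,v)$ is the extension of $h$ by that triple; $H_F$ is the set of histories. $h\to_G h'$ iff $h'=h\parallel(\ell(h),U,\ell(h'))$ for some $U\supseteq G$. $\approx_G$ is the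 transitive closure of $\to_G\cup\to_G^{ -1}$, and $U(F)=(H_F,\{\approx_G\}_G)$. -}

module Defs where

open import Level using (Level; suc; _⊔_)
open import Data.Nat using (ℕ; zero) renaming (suc to sucℕ)
open import Data.Bool using (Bool; true; false)
open import Data.Vec using ([]; _∷_)
open import Data.Fin.Subset using (Subset) renaming (⊥ to ∅; _∪_ to _∪ₛ_; _⊆_ to _⊆ₛ_)
open import Data.Product using (Σ; _×_; _,_; proj₁; proj₂; ∃)
open import Data.Sum using (_⊎_)
open import Data.Empty using (⊥)
open import Data.List using (List; []; _∷_; _++_)
open import Data.List.NonEmpty using (List⁺; _∷_; toList; last; _⁺∷ʳ_)
open import Relation.Binary.PropositionalEquality using (_≡_)
open import Relation.Binary.Construct.Closure.Transitive using (TransClosure)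
open import Relation.Nullary using (¬_)

-- Agents: Ag = Fin n.  Sets of agents: Subset n (canonical bit vectors).
-- A set of sets of agents is represented canonically by a binary trie,
-- i.e. a (canonical, finite) Boolean function on Subset n.
Trie : ℕ → Set
Trie zero     = Bool
Trie (sucℕ n) = Trie n × Trie n

member : ∀ {n} → Trie n → Subset n → Bool
member {zero}   b         []          = b
member {sucℕ n} (t₀ , t₁) (false ∷ s) = member t₀ s
member {sucℕ n} (t₀ , t₁) (true  ∷ s) = member t₁ s

-- An agent pattern: a set of nonempty sets of agents.
AgentPattern : ℕ → Set
AgentPattern n = Σ (Trie n) (λ t → member t ∅ ≡ false)

_∈ₚ_ : ∀ {n} → Subset n → AgentPattern n → Set
A ∈ₚ G = member (proj₁ G) A ≡ true

_⊆ₚ_ : ∀ {n} → AgentPattern n → AgentPattern n → Set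
G ⊆ₚ H = ∀ A → A ∈ₚ G → A ∈ₚ H

IsUnion : ∀ {n} → AgentPattern n → AgentPattern n → AgentPattern n → Set
IsUnion G H K = ∀ A → (A ∈ₚ K → A ∈ₚ G ⊎ A ∈ₚ H) × (A ∈ₚ G ⊎ A ∈ₚ H → A ∈ₚ K)

IsSingleton : ∀ {n} → Subset n → AgentPattern n → Set
IsSingleton A K = ∀ C → (C ∈ₚ K → C ≡ A) × (C ≡ A → C ∈ₚ K)

IsAdd : ∀ {n} → AgentPattern n → Subset n → AgentPattern n → Set
IsAdd G B K = ∀ C → (C ∈ₚ K → C ∈ₚ G ⊎ C ≡ B) × (C ∈ₚ G ⊎ C ≡ B → C ∈ₚ K)

record Frame (n : ℕ) (ℓ r : Level) : Set (suc (ℓ ⊔ r)) where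
  field
    W     : Set ℓ
    rel   : AgentPattern n → W → W → Set r
    sym   : ∀ G {w v} → rel G w v → rel G v w
    trans : ∀ G {w v u} → rel G w v → rel G v u → rel G w u

  alive : AgentPattern n → W → Set r
  alive G w = rel G w w

record IsKappaFrame {n ℓ r} (F : Frame n ℓ r) : Set (ℓ ⊔ r) where
  open Frame F
  field
    K1 : ∀ G H K → IsUnion G H K → ∀ w → alive G w → alive H w → alive K w
    K2 : ∀ G A B → A ∈ₚ G → B ∈ₚ G → ∀ K → IsSingleton (A ∪ₛ B) K →
         ∀ w → alive G w → alive K w
    K3 : ∀ G H → G ⊆ₚ H → ∀ w v → rel H w v → rel G w v
    K4 : ∀ G A B → A ∈ₚ G → ¬ (B ≡ ∅) → B ⊆ₛ A → ∀ K → IsAdd G B K →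
         ∀ w v → rel G w v → rel K w v
    NE : ∀ w → ∃ λ G → alive G w

module Unravel {n ℓ r} (F : Frame n ℓ r) where
  open Frame F

  Triple : Set ℓ
  Triple = W × AgentPattern n × W

  src tgt : Triple → W
  src (w , _ , _) = w
  tgt (_ , _ , v) = v

  ValidTriple : Triple → Set r
  ValidTriple (w , G , v) = rel G w v × (∀ G' → G ⊆ₚ G' → rel G' w v → G' ⊆ₚ G)

  data Chain : Triple → List Triple → Set (ℓ ⊔ r) where
    []  : ∀ {x} → Chain x []
    _∷_ : ∀ {x y ys} → ValidTriple y × tgt x ≡ src y → Chain y ys → Chain x (y ∷ ys)

  IsHistory : List⁺ Triple → Set (ℓ ⊔ r)
  IsHistory (x ∷ xs) = ValidTriple x × Chain x xs

  History : Set (ℓ ⊔ r)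
  History = Σ (List⁺ Triple) IsHistory

  lastWorld : History → W
  lastWorld h = tgt (last (proj₁ h))

  Step : AgentPattern n → History → History → Set ℓ
  Step G h h' = ∃ λ U → G ⊆ₚ U × (proj₁ h' ≡ proj₁ h ⁺∷ʳ (lastWorld h , U , lastWorld h'))

  StepSym : AgentPattern n → History → History → Set ℓ
  StepSym G h h' = Step G h h' ⊎ Step G h' h

  _≈[_]_ : History → AgentPattern n → History → Set (ℓ ⊔ r)
  h ≈[ G ] h' = TransClosure (StepSym G) h h'

  IsPrefix : History → History → Set ℓ
  IsPrefix p h = ∃ λ (rest : List Triple) → toList (proj₁ h) ≡ toList (proj₁ p) ++ rest

-- A step h →_G h' only appends a triple to h, so it leaves the first triple
-- unchanged; hence ≈_G-related histories start with the same triple, and the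
-- one-triple history made of it is a common prefix.
module Submission where

open import Defs
open import Data.Nat using (ℕ)
open import Level using (Level)
open import Data.Product using (Σ; _×_; _,_)
open import Data.Sum using (inj₁; inj₂)
open import Data.List using ([])
open import Data.List.NonEmpty using (_∷_; head)
open import Relation.Binary.Core using (Rel; _=[_]⇒_)
open import Relation.Binary.PropositionalEquality using (_≡_; refl; sym; trans; cong)
open import Relation.Binary.Construct.Closure.Transitive using (TransClosure; [_]; _∷_)

TransClosure-invariant : ∀ {a b ℓ} {A : Set a} {B : Set b} {R : Rel A ℓ} {f : A → B} →
                         R =[ f ]⇒ _≡_ → TransClosure R =[ f ]⇒ _≡_
TransClosure-invariant R⇒≡ [ xRy ]      = R⇒≡ xRy
TransClosure-invariant R⇒≡ (xRy ∷ yR⁺z) = trans (R⇒≡ xRy) (TransClosure-invariant R⇒≡ yR⁺z)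

module Root {n ℓ r} (F : Frame n ℓ r) where
  open Unravel F

  root : History → Triple
  root (h , _) = head h

  rootHistory : History → History
  rootHistory ((x ∷ _) , valid , _) = (x ∷ []) , valid , []

  rootHistory-isPrefix : ∀ h h' → root h ≡ root h' → IsPrefix (rootHistory h) h'
  rootHistory-isPrefix ((x ∷ _) , _) ((.x ∷ rest) , _) refl = rest , refl

  Step-root : ∀ G h h' → Step G h h' → root h ≡ root h'
  Step-root G ((_ ∷ _) , _) h' (_ , _ , h'≡h∷ʳt) = sym (cong head h'≡h∷ʳt)

  StepSym-root : ∀ G h h' → StepSym G h h' → root h ≡ root h'
  StepSym-root G h h' (inj₁ h→h') = Step-root G h h' h→h'
  StepSym-root G h h' (inj₂ h'→h) = sym (Step-root G h' h h'→h)

  ≈-root : ∀ G → (_≈[ G ]_) =[ root ]⇒ _≡_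
  ≈-root G = TransClosure-invariant (λ {h} {h'} → StepSym-root G h h')

lemma5p31 : ∀ {ℓ r : Level} (n : ℕ) (F : Frame n ℓ r) → IsKappaFrame F →
    let open Unravel F in
    ∀ (G : AgentPattern n) (h₁ hₙ : History) → h₁ ≈[ G ] hₙ →
      Σ History (λ p → IsPrefix p h₁ × IsPrefix p hₙ)
lemma5p31 n F _ G h₁ hₙ h₁≈hₙ =
  rootHistory h₁ , rootHistory-isPrefix h₁ h₁ refl , rootHistory-isPrefix h₁ hₙ (≈-root G h₁≈hₙ)
  where open Root F
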